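{- Let $n,f$ be positive integers with $n>10f$. Let $G$ be a simple graph on $n$ vertices and $m$ edges (with some ordering $e_1,\dots,e_m$ of its edges) that admits an $f$-MFD connectivity blocking set. Then $m=O(fn\log(n/f))$. In particular, for every simple $n$-vertex graph $G$, the output $H$ of the algorithm FTGreedyMFDCertificate$(G,f)$ has $O(fn\log(n/f))$ edges.
   Context: For $G=(V,E)$ and $F\subseteq V\cup E$, $G-F$ is the graph obtained by deleting the vertices in $F\cap V$ (with their incident edges) and the edges in $F\cap E$. For $v\in V$ let $\deg_G(v,F)=|\{u\in N_G(v): u\in F\text{ or }\{u,v\}\in F\}|$ and $\deg_G(F)=\max_{v\in V\setminus F}\deg_G(v,F)$. A set $F$ damages an edge $e$ if $e$ is not an edge of $G-F$. Write $e_i=\{u_i,v_i\}$ and $G_{<i}=(V,\{e_1,\dots,e_{i-1}\})$. A connectivity blocking set for $G$ with ordered edges $e_1,\dots,e_m$ is a collection $\{(e_i,F_i)\}_{i=1}^m$ with $F_i\subseteq V\cup E$ such that (1) $F_i$ does not damage $e_i$, and (2) $u_i$ and $v_i$ are disconnected in $G_{<i}-F_i$; it is an $f$-MFD connectivity blocking set if also $\deg_G(F_i)\le f$ for all $i$. Algorithm FTGreedyMFDCertificate$(G,f)$: fix an ordering $e_1,\dots,e_m$ of $E$; start with $H=(V,\emptyset)$; for $i=1,\dots,m$, if there exists $F\subseteq V\cup E$ with $\deg_G(F)\le f$ that does not damage $e_i$ and such that $u_i,v_i$ are disconnected in $H-F$, add $e_i$ to $H$; return $H$. $\log$ is base $2$.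 -}

module Defs where

open import Data.Nat using (ℕ; _≤_)
open import Data.Fin using (Fin; toℕ)
open import Data.Fin.Properties using (_≟_)
open import Data.Fin.Subset using (Subset; _∈_; _∉_)
open import Data.Fin.Subset.Properties using (_∈?_)
open import Data.List using (List; []; _∷_; _++_; [_]; length; filter; take; lookup; allFin)
open import Data.List.Relation.Unary.All using (All)
open import Data.List.Relation.Unary.Any using (Any; any?)
open import Data.List.Relation.Unary.AllPairs using (AllPairs)
open import Data.Product using (_×_; _,_; Σ; proj₁; proj₂)
open import Data.Sum using (_⊎_)
open import Relation.Binary.PropositionalEquality using (_≡_; _≢_)
open import Relation.Nullary using (¬_; Dec)
open import Relation.Nullary.Decidable using (_×-dec_; _⊎-dec_)

-- Vertices of an n-vertex graph are Fin n.
-- An edge {u,v} is stored as an ordered pair (u , v); orientation is irrelevant.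
Edge : ℕ → Set
Edge n = Fin n × Fin n

SameEdge : ∀ {n} → Edge n → Edge n → Set
SameEdge (u , v) (x , y) = ((u ≡ x) × (v ≡ y)) ⊎ ((u ≡ y) × (v ≡ x))

sameEdge? : ∀ {n} (e e' : Edge n) → Dec (SameEdge e e')
sameEdge? (u , v) (x , y) = ((u ≟ x) ×-dec (v ≟ y)) ⊎-dec ((u ≟ y) ×-dec (v ≟ x))

-- A graph on vertex set Fin n given by its list of edges e₁,…,eₘ
-- (the list order is the edge ordering).
EdgeList : ℕ → Set
EdgeList n = List (Edge n)

IsSimple : ∀ {n} → EdgeList n → Set
IsSimple es = All (λ e → proj₁ e ≢ proj₂ e) es × AllPairs (λ e e' → ¬ SameEdge e e') es

HasEdge : ∀ {n} → EdgeList n → Fin n → Fin n → Set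
HasEdge es u v = Any (SameEdge (u , v)) es

hasEdge? : ∀ {n} (es : EdgeList n) (u v : Fin n) → Dec (HasEdge es u v)
hasEdge? es u v = any? (sameEdge? (u , v)) es

record FaultSet (n : ℕ) : Set where
  constructor mkF
  field
    FV : Subset n
    FE : EdgeList n
open FaultSet public

degAt : ∀ {n} → EdgeList n → FaultSet n → Fin n → ℕ
degAt {n} G F v =
  length (filter (λ u → hasEdge? G v u ×-dec ((u ∈? FV F) ⊎-dec hasEdge? (FE F) u v))
                 (allFin n))

DegBounded : ∀ {n} → EdgeList n → FaultSet n → ℕ → Set
DegBounded G F f = ∀ v → v ∉ FV F → degAt G F v ≤ f

Damages : ∀ {n} → FaultSet n → Edge n → Set
Damages F (u , v) = (u ∈ FV F) ⊎ (v ∈ FV F) ⊎ HasEdge (FE F) u v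

data Connected {n} (H : EdgeList n) (F : FaultSet n) (u : Fin n) : Fin n → Set where
  here : u ∉ FV F → Connected H F u u
  step : ∀ {w x} → Connected H F u w → HasEdge H w x → ¬ HasEdge (FE F) w x →
         x ∉ FV F → Connected H F u x

Blocks : ∀ {n} → EdgeList n → ℕ → EdgeList n → Edge n → FaultSet n → Set
Blocks G f H e F =
  DegBounded G F f × ¬ Damages F e × ¬ Connected H F (proj₁ e) (proj₂ e)

HasMFDBlockingSet : ∀ {n} → EdgeList n → ℕ → Set
HasMFDBlockingSet {n} G f =
  (i : Fin (length G)) →
  Σ (FaultSet n) (Blocks G f (take (toℕ i) G) (lookup G i))

-- Relational description of FTGreedyMFDCertificate(G,f):
-- GreedyRun G f rest H out : processing the remaining edges 'rest' starting
-- from current graph H ends with output 'out'.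
data GreedyRun {n} (G : EdgeList n) (f : ℕ) : EdgeList n → EdgeList n → EdgeList n → Set where
  done : ∀ {H} → GreedyRun G f [] H H
  add  : ∀ {e rest H out} → Σ (FaultSet n) (Blocks G f H e) →
         GreedyRun G f rest (H ++ [ e ]) out → GreedyRun G f (e ∷ rest) H out
  skip : ∀ {e rest H out} → ¬ Σ (FaultSet n) (Blocks G f H e) →
         GreedyRun G f rest H out → GreedyRun G f (e ∷ rest) H out

GreedyOutput : ∀ {n} → EdgeList n → ℕ → EdgeList n → Set
GreedyOutput G f H = GreedyRun G f G [] H

{-# OPTIONS --safe #-}
module Submission where

-- Let L be a sequence of edges of G inside a vertex set W, each blocked by the
-- edges before it, and let uv be its last edge, blocked by F.  The components
-- of u and of v in (L − uv) − F are disjoint; let R be the one meeting W in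
-- fewer vertices.  An edge ab of L − uv with a ∈ R and b ∉ R must have b ∈ F
-- or ab ∈ F, so b is one of the at most f neighbours counted by deg_G(a, F):
-- at most |W ∩ R| · min(f, |W ∖ R|) edges cross the cut.  The edges inside and
-- outside R form blocked sequences again, so by induction 1 + |L| ≤ Ψ(|W|) for
--   Ψ(w) = w · min(w, 2f) + f · w · ⌊log₂(w/f)⌋ + w,
-- which satisfies Ψ(s) + Ψ(t) + s · min(f, t) ≤ Ψ(s + t) for s ≤ t; and
-- Ψ(n) ≤ 2fn⌊log₂(n/f)⌋ once n > 10f.  Both an MFD blocking set and a run of
-- the greedy algorithm yield blocked sequences.

open import Defs
open import Data.Empty using (⊥-elim)
open import Data.Fin using (Fin; zero; suc; fromℕ<)
open import Data.Fin.Properties using (_≟_; any?; toℕ-fromℕ<)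
open import Data.Fin.Subset
  using (Subset; inside; outside; _∈_; _∉_; _∩_; _∪_; _─_; _-_; ⁅_⁆; ⊤; ∣_∣; Nonempty)
open import Data.Fin.Subset.Properties
  using (_∈?_; ∈⊤; ∣⊤∣≡n; ∣p∣≤n; x∈⁅x⁆; x∈⁅y⁆⇒x≡y; p⊆p∪q; q⊆p∪q; x∈p∪q⁻; x∈p∩q⁺; x∈p∩q⁻;
         p─q⊆p; x∈p∧x∉q⇒x∈p─q; x∈p∧x≢y⇒x∈p-y; x∈p⇒∣p-x∣<∣p∣; p⊆q⇒∣p∣≤∣q∣; p⊂q⇒∣p∣<∣q∣;
         ∣p∩q∣≤∣p∣; ∣p∩q∣≤∣q∣)
open import Data.List using (List; []; _∷_; [_]; _∷ʳ_; length; filter; take; lookup; tabulate; map)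
open import Data.List.Properties using (length-map; length-++; filter-++; ++-identityʳ; take-suc; take-all)
open import Data.List.Membership.Propositional using () renaming (_∈_ to _∈ₗ_)
open import Data.List.Membership.Propositional.Properties using (∈-lookup)
open import Data.List.Relation.Unary.All using (All; []; _∷_)
import Data.List.Relation.Unary.All as All
import Data.List.Relation.Unary.All.Properties as All
open import Data.List.Relation.Unary.AllPairs using (AllPairs; []; _∷_)
import Data.List.Relation.Unary.AllPairs as AllPairs
import Data.List.Relation.Unary.AllPairs.Properties as AllPairs
import Data.List.Relation.Unary.Any as Any
import Data.List.Relation.Unary.Any.Properties as Any
open import Data.List.Relation.Unary.Unique.Propositional using (Unique)
import Data.List.Relation.Unary.Unique.Propositional.Properties as Unique
open import Data.Nat
  using (ℕ; zero; suc; _+_; _*_; _≤_; _<_; _⊓_; z≤n; s≤s; _≤?_; _<?_; NonZero; >-nonZero)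
open import Data.Nat.DivMod using (_/_; m*n/n≡m; /-monoˡ-≤; m<n⇒m/n≡0; m/n*n≤m)
open import Data.Nat.Induction using (<-wellFounded)
open import Data.Nat.Logarithm using (⌊log₂_⌋; ⌊log₂⌋-mono-≤; ⌊log₂[2*b]⌋≡1+⌊log₂b⌋)
open import Data.Nat.Properties
  using (≤-refl; ≤-trans; <-≤-trans; <⇒≤; <⇒≱; ≰⇒>; ≮⇒≥; n≤1+n; m≤m+n; m≤n+m; m<m+n; m<n+m;
         m≤n*m; +-comm; +-suc; +-identityʳ; *-assoc; *-identityˡ; +-mono-≤; +-monoˡ-≤; +-monoʳ-≤;
         *-monoˡ-≤; *-monoʳ-≤; ⊓-glb; m⊓n≤m; m⊓n≤n; m≤n⇒m⊓n≡m; m≥n⇒m⊓n≡n; module ≤-Reasoning)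
open import Data.Nat.Solver using (module +-*-Solver)
open +-*-Solver using (solve; _:+_; _:*_; _:=_; con)
open import Data.Product using (Σ; _×_; _,_; ∃; ∃₂; proj₁; proj₂)
open import Data.Sum using (_⊎_; inj₁; inj₂)
open import Data.Vec using ([]; _∷_)
import Data.Vec as Vec
open import Data.Vec.Properties using (lookup∘tabulate; []=⇒lookup; lookup⇒[]=)
open import Function using (_∘_; id)
open import Induction.WellFounded using (Acc; acc)
open import Level using (0ℓ)
open import Relation.Binary.PropositionalEquality using (_≡_; refl; sym; trans; cong; cong₂; subst)
open import Relation.Nullary using (¬_; Dec; yes; no; does; ¬?)
open import Relation.Nullary.Decidable using (dec-true; _×-dec_; _⊎-dec_)
open import Relation.Unary using (Pred; Decidable)

private variable
  n : ℕ

-- Counting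

∣p∣≡∣p∩q∣+∣p─q∣ : (p q : Subset n) → ∣ p ∣ ≡ ∣ p ∩ q ∣ + ∣ p ─ q ∣
∣p∣≡∣p∩q∣+∣p─q∣ []            []            = refl
∣p∣≡∣p∩q∣+∣p─q∣ (inside ∷ p)  (inside ∷ q)  = cong suc (∣p∣≡∣p∩q∣+∣p─q∣ p q)
∣p∣≡∣p∩q∣+∣p─q∣ (inside ∷ p)  (outside ∷ q) = trans (cong suc (∣p∣≡∣p∩q∣+∣p─q∣ p q)) (sym (+-suc _ _))
∣p∣≡∣p∩q∣+∣p─q∣ (outside ∷ p) (inside ∷ q)  = ∣p∣≡∣p∩q∣+∣p─q∣ p q
∣p∣≡∣p∩q∣+∣p─q∣ (outside ∷ p) (outside ∷ q) = ∣p∣≡∣p∩q∣+∣p─q∣ p q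

x∈p⇒1≤∣p∣ : ∀ {x} {p : Subset n} → x ∈ p → 1 ≤ ∣ p ∣
x∈p⇒1≤∣p∣ x∈p = ≤-trans (s≤s z≤n) (x∈p⇒∣p-x∣<∣p∣ x∈p)

unique⇒length≤∣p∣ : {p : Subset n} {xs : List (Fin n)} →
                    Unique xs → All (_∈ p) xs → length xs ≤ ∣ p ∣
unique⇒length≤∣p∣ []             []           = z≤n
unique⇒length≤∣p∣ (x∉xs ∷ uxs) (x∈p ∷ xs⊆p) =
  <-≤-trans (s≤s (unique⇒length≤∣p∣ uxs xs⊆p-x)) (x∈p⇒∣p-x∣<∣p∣ x∈p)
  where xs⊆p-x = All.zipWith (λ (x≢y , y∈p) → x∈p∧x≢y⇒x∈p-y y∈p (x≢y ∘ sym)) (x∉xs , xs⊆p)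

module _ {P : Pred (Fin n) 0ℓ} (P? : Decidable P) where

  fromDec : Subset n
  fromDec = Vec.tabulate (does ∘ P?)

  ∈-fromDec⁺ : ∀ {x} → P x → x ∈ fromDec
  ∈-fromDec⁺ {x} px = lookup⇒[]= x fromDec (trans (lookup∘tabulate _ x) (dec-true (P? x) px))

  ∈-fromDec⁻ : ∀ {x} → x ∈ fromDec → P x
  ∈-fromDec⁻ {x} x∈ with P? x | trans (sym (lookup∘tabulate (does ∘ P?) x)) ([]=⇒lookup x∈)
  ... | yes px | _ = px
  ... | no  _  | ()

∣fromDec∣≡length-filter : ∀ {A : Set} {P : Pred A 0ℓ} (P? : Decidable P) (g : Fin n → A) →
                          ∣ fromDec (P? ∘ g) ∣ ≡ length (filter P? (tabulate g))
∣fromDec∣≡length-filter {zero}  P? g = refl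
∣fromDec∣≡length-filter {suc n} P? g with P? (g zero)
... | yes _ = cong suc (∣fromDec∣≡length-filter P? (g ∘ suc))
... | no  _ = ∣fromDec∣≡length-filter P? (g ∘ suc)

length≡length-filter+length-filter¬ : ∀ {A : Set} {P : Pred A 0ℓ} (P? : Decidable P) (xs : List A) →
  length xs ≡ length (filter P? xs) + length (filter (¬? ∘ P?) xs)
length≡length-filter+length-filter¬ P? [] = refl
length≡length-filter+length-filter¬ P? (x ∷ xs) with P? x
... | yes _ = cong suc (length≡length-filter+length-filter¬ P? xs)
... | no  _ = trans (cong suc (length≡length-filter+length-filter¬ P? xs)) (sym (+-suc _ _))

unique-map-proj₂ : {A B : Set} {a : A} {ps : List (A × B)} →
                   Unique ps → All ((_≡ a) ∘ proj₁) ps → Unique (map proj₂ ps)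
unique-map-proj₂ []             []           = []
unique-map-proj₂ (p∉ps ∷ ups) (refl ∷ fsts) =
  All.map⁺ (All.zipWith (λ { (p≢q , refl) refl → p≢q refl }) (p∉ps , fsts)) ∷ unique-map-proj₂ ups fsts

length≤∣p∣*k : {k : ℕ} (A : Subset n) (N : Fin n → Subset n) →
               (∀ {a} → a ∈ A → ∣ N a ∣ ≤ k) →
               {ps : List (Fin n × Fin n)} → Unique ps → All (λ (a , b) → a ∈ A × b ∈ N a) ps →
               length ps ≤ ∣ A ∣ * k
length≤∣p∣*k {k = k} A N ∣N∣≤k = go A ∣N∣≤k (<-wellFounded ∣ A ∣)
  where
  go : ∀ A → (∀ {a} → a ∈ A → ∣ N a ∣ ≤ k) → Acc _<_ ∣ A ∣ → ∀ {ps} → Unique ps →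
       All (λ (a , b) → a ∈ A × b ∈ N a) ps → length ps ≤ ∣ A ∣ * k
  go A ∣N∣≤k _ [] [] = z≤n
  go A ∣N∣≤k (acc rec) {ps@((a , _) ∷ _)} ups ps⊆ = begin
    length ps                     ≡⟨ length≡length-filter+length-filter¬ at-a? ps ⟩
    length fibre + length others  ≤⟨ +-mono-≤ fibre-bound others-bound ⟩
    k + ∣ A - a ∣ * k              ≤⟨ *-monoˡ-≤ k (x∈p⇒∣p-x∣<∣p∣ a∈A) ⟩
    ∣ A ∣ * k                      ∎
    where
    open ≤-Reasoning
    a∈A = proj₁ (All.head ps⊆)
    at-a? = λ (p : Fin _ × Fin _) → proj₁ p ≟ a
    fibre = filter at-a? ps
    others = filter (¬? ∘ at-a?) ps
    fibre-bound : length fibre ≤ k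
    fibre-bound = begin
      length fibre              ≡⟨ length-map proj₂ fibre ⟨
      length (map proj₂ fibre)  ≤⟨ unique⇒length≤∣p∣ (unique-map-proj₂ (Unique.filter⁺ at-a? ups) at-a)
                                     (All.map⁺ (All.zipWith (λ { (refl , _ , b∈N) → b∈N })
                                                            (at-a , All.filter⁺ at-a? ps⊆))) ⟩
      ∣ N a ∣                    ≤⟨ ∣N∣≤k a∈A ⟩
      k                         ∎
      where at-a = All.all-filter at-a? ps
    others-bound : length others ≤ ∣ A - a ∣ * k
    others-bound = go (A - a) (∣N∣≤k ∘ p─q⊆p A _) (rec (x∈p⇒∣p-x∣<∣p∣ a∈A))
                      (Unique.filter⁺ (¬? ∘ at-a?) ups)
      (All.zipWith (λ { (x≢a , x∈A , y∈N) → x∈p∧x≢y⇒x∈p-y x∈A x≢a , y∈N })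
                   (All.all-filter (¬? ∘ at-a?) ps , All.filter⁺ (¬? ∘ at-a?) ps⊆))

-- Connectivity in H − F

HasEdge-sym : (H : EdgeList n) {u v : Fin n} → HasEdge H u v → HasEdge H v u
HasEdge-sym H = Any.map λ { (inj₁ (refl , refl)) → inj₂ (refl , refl)
                           ; (inj₂ (refl , refl)) → inj₁ (refl , refl) }

module _ {H : EdgeList n} {F : FaultSet n} where

  Connected-end∉ : ∀ {u x} → Connected H F u x → x ∉ FV F
  Connected-end∉ (here x∉F)       = x∉F
  Connected-end∉ (step _ _ _ x∉F) = x∉F

  Connected-trans : ∀ {u w x} → Connected H F u w → Connected H F w x → Connected H F u x
  Connected-trans c (here _)               = c
  Connected-trans c (step c′ wx wx∉F x∉F) = step (Connected-trans c c′) wx wx∉F x∉F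

  Connected-sym : ∀ {u x} → Connected H F u x → Connected H F x u
  Connected-sym (here u∉F)           = here u∉F
  Connected-sym (step c wx wx∉F x∉F) =
    Connected-trans (step (here x∉F) (HasEdge-sym H wx) (wx∉F ∘ HasEdge-sym (FE F)) (Connected-end∉ c))
                    (Connected-sym c)

Connected-mono : {H H′ : EdgeList n} {F : FaultSet n} → (∀ {x y} → HasEdge H x y → HasEdge H′ x y) →
                 ∀ {u x} → Connected H F u x → Connected H′ F u x
Connected-mono H⊆H′ (here u∉F)           = here u∉F
Connected-mono H⊆H′ (step c wx wx∉F x∉F) = step (Connected-mono H⊆H′ c) (H⊆H′ wx) wx∉F x∉F

module _ (H : EdgeList n) (F : FaultSet n) where

  Step : Fin n → Fin n → Set
  Step x y = HasEdge H x y × ¬ HasEdge (FE F) x y × y ∉ FV F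

  step? : ∀ x y → Dec (Step x y)
  step? x y = hasEdge? H x y ×-dec ¬? (hasEdge? (FE F) x y) ×-dec ¬? (y ∈? FV F)

  Closed : Subset n → Set
  Closed R = ∀ {x y} → x ∈ R → Step x y → y ∈ R

  record Component (u : Fin n) : Set where
    field
      vertices  : Subset n
      ∋-source  : u ∈ vertices
      connected : ∀ {x} → x ∈ vertices → Connected H F u x
      closed    : Closed vertices

  private
    Escape : Subset n → Set
    Escape R = ∃₂ λ x y → x ∈ R × Step x y × y ∉ R

    escape? : ∀ R → Dec (Escape R)
    escape? R = any? λ x → any? λ y → x ∈? R ×-dec step? x y ×-dec ¬? (y ∈? R)

    ¬escape⇒closed : ∀ {R} → ¬ Escape R → Closed R
    ¬escape⇒closed {R} ¬esc {x} {y} x∈R xy with y ∈? R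
    ... | yes y∈R = y∈R
    ... | no  y∉R = ⊥-elim (¬esc (x , y , x∈R , xy , y∉R))

    entered? : (R : Subset n) → ∀ y → Dec (∃ λ x → x ∈ R × Step x y)
    entered? R y = any? λ x → x ∈? R ×-dec step? x y

    grow : Subset n → Subset n
    grow R = R ∪ fromDec (entered? R)

    ∣R∣<∣grow∣ : ∀ {R} → Escape R → ∣ R ∣ < ∣ grow R ∣
    ∣R∣<∣grow∣ {R} (x , y , x∈R , xy , y∉R) =
      p⊂q⇒∣p∣<∣q∣ (p⊆p∪q _ , y , q⊆p∪q R _ (∈-fromDec⁺ (entered? R) (x , x∈R , xy)) , y∉R)

    grow-connected : ∀ {u R} → (∀ {x} → x ∈ R → Connected H F u x) →
                     ∀ {y} → y ∈ grow R → Connected H F u y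
    grow-connected {R = R} conn y∈ with x∈p∪q⁻ R (fromDec (entered? R)) y∈
    ... | inj₁ y∈R   = conn y∈R
    ... | inj₂ y∈new with ∈-fromDec⁻ (entered? R) y∈new
    ...   | x , x∈R , (xy , xy∉F , y∉F) = step (conn x∈R) xy xy∉F y∉F

    -- Each round either finds R closed or strictly enlarges it, so n + 1 rounds suffice.
    explore : ∀ {u} k R → u ∈ R → (∀ {x} → x ∈ R → Connected H F u x) → n < k + ∣ R ∣ →
              Component u
    explore zero    R _ _ n<∣R∣ = ⊥-elim (<⇒≱ n<∣R∣ (∣p∣≤n R))
    explore (suc k) R u∈R conn n<1+k+∣R∣ with escape? R
    ... | no ¬esc = record
      { vertices = R ; ∋-source = u∈R ; connected = conn ; closed = ¬escape⇒closed ¬esc }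
    ... | yes esc = explore k (grow R) (p⊆p∪q _ u∈R) (grow-connected conn)
      (<-≤-trans n<1+k+∣R∣ (subst (_≤ k + ∣ grow R ∣) (+-suc k _) (+-monoʳ-≤ k (∣R∣<∣grow∣ esc))))

  component : ∀ {u} → u ∉ FV F → Component u
  component {u} u∉F =
    explore (suc n) ⁅ u ⁆ (x∈⁅x⁆ u)
            (λ x∈ → subst (Connected H F u) (sym (x∈⁅y⁆⇒x≡y u x∈)) (here u∉F))
            (m≤m+n (suc n) _)

-- Blocked edge sequences

EdgeOf : EdgeList n → Edge n → Set
EdgeOf H (u , v) = HasEdge H u v

∈⇒EdgeOf : {H : EdgeList n} {e : Edge n} → e ∈ₗ H → EdgeOf H e
∈⇒EdgeOf = Any.map λ { refl → inj₁ (refl , refl) }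

Distinct : EdgeList n → Set
Distinct = AllPairs (λ e e′ → ¬ SameEdge e e′)

module _ (G : EdgeList n) (f : ℕ) where

  Blocking : EdgeList n → Edge n → Set
  Blocking P e = Σ (FaultSet n) (Blocks G f P e)

  data Blocked : EdgeList n → Set where
    []   : Blocked []
    snoc : ∀ {P e} → Blocked P → EdgeOf G e → Blocking P e → Blocked (P ∷ʳ e)

  Blocking-mono : ∀ {P P′ e} → (∀ {x y} → HasEdge P x y → HasEdge P′ x y) →
                  Blocking P′ e → Blocking P e
  Blocking-mono P⊆P′ (F , deg≤f , ¬dmg , ¬conn) = F , deg≤f , ¬dmg , ¬conn ∘ Connected-mono P⊆P′

  Blocked-filter : {Q : Pred (Edge n) 0ℓ} (Q? : Decidable Q) → ∀ {L} → Blocked L → Blocked (filter Q? L)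
  Blocked-filter Q? [] = []
  Blocked-filter Q? (snoc {P} {e} bP eG β) rewrite filter-++ Q? P [ e ] with Q? e
  ... | yes _ = snoc (Blocked-filter Q? bP) eG (Blocking-mono (Any.filter⁻ Q?) β)
  ... | no  _ = subst Blocked (sym (++-identityʳ _)) (Blocked-filter Q? bP)

  Blocking⇒fresh : ∀ {P e} → Blocking P e → All (λ e′ → ¬ SameEdge e′ e) P
  Blocking⇒fresh (F , _ , ¬dmg , ¬conn) = All.tabulate λ e′∈P same →
    ¬conn (step (here (¬dmg ∘ inj₁)) (Any.map (λ { refl → SameEdge-sym same }) e′∈P)
                (¬dmg ∘ inj₂ ∘ inj₂) (¬dmg ∘ inj₂ ∘ inj₁))
    where
    SameEdge-sym : ∀ {e e′ : Edge n} → SameEdge e e′ → SameEdge e′ e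
    SameEdge-sym (inj₁ (refl , refl)) = inj₁ (refl , refl)
    SameEdge-sym (inj₂ (refl , refl)) = inj₂ (refl , refl)

  Blocked⇒Distinct : ∀ {L} → Blocked L → Distinct L
  Blocked⇒Distinct []             = []
  Blocked⇒Distinct (snoc bP _ β) =
    AllPairs.++⁺ (Blocked⇒Distinct bP) ([] ∷ []) (All.map (_∷ []) (Blocking⇒fresh β))

  Blocked⇒EdgesOf : ∀ {L} → Blocked L → All (EdgeOf G) L
  Blocked⇒EdgesOf []              = []
  Blocked⇒EdgesOf (snoc bP eG _) = All.++⁺ (Blocked⇒EdgesOf bP) (eG ∷ [])

  MFD⇒Blocked : HasMFDBlockingSet G f → Blocked G
  MFD⇒Blocked blocking = subst Blocked (take-all (length G) G ≤-refl) (prefix (length G) ≤-refl)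
    where
    prefix : ∀ k → k ≤ length G → Blocked (take k G)
    prefix zero    _     = []
    prefix (suc k) k<∣G∣ =
      subst Blocked (sym take-suc-k)
        (snoc (prefix k (<⇒≤ k<∣G∣)) (∈⇒EdgeOf (∈-lookup i))
              (subst (λ m → Blocking (take m G) (lookup G i)) (toℕ-fromℕ< k<∣G∣) (blocking i)))
      where
      i = fromℕ< k<∣G∣
      take-suc-k : take (suc k) G ≡ take k G ∷ʳ lookup G i
      take-suc-k = subst (λ m → take (suc m) G ≡ take m G ∷ʳ lookup G i)
                         (toℕ-fromℕ< k<∣G∣) (take-suc G i)

  Greedy⇒Blocked : ∀ {H} → GreedyOutput G f H → Blocked H
  Greedy⇒Blocked = run (All.tabulate ∈⇒EdgeOf) []
    where
    run : ∀ {rest H out} → All (EdgeOf G) rest → Blocked H → GreedyRun G f rest H out → Blocked out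
    run _           bH done       = bH
    run (eG ∷ rest) bH (add β r)  = run rest (snoc bH eG β) r
    run (_  ∷ rest) bH (skip _ r) = run rest bH r

-- Cuts

Within : Subset n → Edge n → Set
Within W (x , y) = x ∈ W × y ∈ W

Crosses : Subset n → Edge n → Set
Crosses R (x , y) = (x ∈ R × y ∉ R) ⊎ (x ∉ R × y ∈ R)

orient : Subset n → Edge n → Edge n
orient R (x , y) with x ∈? R
... | yes _ = x , y
... | no  _ = y , x

module _ {R : Subset n} where

  EdgeOf-orient : (H : EdgeList n) {e : Edge n} → EdgeOf H e → EdgeOf H (orient R e)
  EdgeOf-orient H {x , y} with x ∈? R
  ... | yes _ = id
  ... | no  _ = HasEdge-sym H

  orient-injective : ∀ {e e′ : Edge n} → orient R e ≡ orient R e′ → SameEdge e e′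
  orient-injective {x , y} {x′ , y′} with x ∈? R | x′ ∈? R
  ... | yes _ | yes _ = λ { refl → inj₁ (refl , refl) }
  ... | yes _ | no  _ = λ { refl → inj₂ (refl , refl) }
  ... | no  _ | yes _ = λ { refl → inj₂ (refl , refl) }
  ... | no  _ | no  _ = λ { refl → inj₁ (refl , refl) }

  orient-crosses : ∀ {W} {e : Edge n} → Within W e → Crosses R e →
                   let (a , b) = orient R e in (a ∈ W × a ∈ R) × (b ∈ W × b ∉ R)
  orient-crosses {e = x , y} (x∈W , y∈W) cr with x ∈? R | cr
  ... | yes x∈R | inj₁ (_ , y∉R) = (x∈W , x∈R) , (y∈W , y∉R)
  ... | yes x∈R | inj₂ (x∉R , _) = ⊥-elim (x∉R x∈R)
  ... | no  x∉R | inj₁ (x∈R , _) = ⊥-elim (x∉R x∈R)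
  ... | no  x∉R | inj₂ (_ , y∈R) = (y∈W , y∈R) , (x∈W , x∉R)

module _ (R : Subset n) where

  BothIn BothOut : Edge n → Set
  BothIn  (x , y) = x ∈ R × y ∈ R
  BothOut (x , y) = x ∉ R × y ∉ R

  bothIn? : ∀ e → Dec (BothIn e)
  bothIn? (x , y) = x ∈? R ×-dec y ∈? R

  bothOut? : ∀ e → Dec (BothOut e)
  bothOut? (x , y) = ¬? (x ∈? R) ×-dec ¬? (y ∈? R)

  insideEdges outsideEdges crossingEdges : EdgeList n → EdgeList n
  insideEdges   = filter bothIn?
  outsideEdges  = filter bothOut? ∘ filter (¬? ∘ bothIn?)
  crossingEdges = filter (¬? ∘ bothOut?) ∘ filter (¬? ∘ bothIn?)

  length-partition : ∀ P → length P ≡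
                     length (insideEdges P) + (length (outsideEdges P) + length (crossingEdges P))
  length-partition P = trans (length≡length-filter+length-filter¬ bothIn? P)
    (cong (length (insideEdges P) +_) (length≡length-filter+length-filter¬ bothOut? (filter (¬? ∘ bothIn?) P)))

  insideEdges-within : ∀ {W P} → All (Within W) P → All (Within (W ∩ R)) (insideEdges P)
  insideEdges-within {P = P} P⊆W =
    All.zipWith (λ ((x∈W , y∈W) , (x∈R , y∈R)) → x∈p∩q⁺ (x∈W , x∈R) , x∈p∩q⁺ (y∈W , y∈R))
      (All.filter⁺ bothIn? P⊆W , All.all-filter bothIn? P)

  outsideEdges-within : ∀ {W P} → All (Within W) P → All (Within (W ─ R)) (outsideEdges P)
  outsideEdges-within {P = P} P⊆W =
    All.zipWith (λ ((x∈W , y∈W) , (x∉R , y∉R)) → x∈p∧x∉q⇒x∈p─q x∈W x∉R , x∈p∧x∉q⇒x∈p─q y∈W y∉R)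
      (All.filter⁺ bothOut? (All.filter⁺ (¬? ∘ bothIn?) P⊆W) ,
       All.all-filter bothOut? (filter (¬? ∘ bothIn?) P))

  crossingEdges⁺ : ∀ {Q : Edge n → Set} {P} → All Q P → All Q (crossingEdges P)
  crossingEdges⁺ = All.filter⁺ (¬? ∘ bothOut?) ∘ All.filter⁺ (¬? ∘ bothIn?)

  crossingEdges-cross : ∀ P → All (Crosses R) (crossingEdges P)
  crossingEdges-cross P = All.zipWith neither⇒crosses
    (All.all-filter (¬? ∘ bothOut?) (filter (¬? ∘ bothIn?) P) ,
     All.filter⁺ (¬? ∘ bothOut?) (All.all-filter (¬? ∘ bothIn?) P))
    where
    neither⇒crosses : ∀ {e} → ¬ BothOut e × ¬ BothIn e → Crosses R e
    neither⇒crosses {x , y} (¬out , ¬in) with x ∈? R | y ∈? R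
    ... | yes x∈R | yes y∈R = ⊥-elim (¬in (x∈R , y∈R))
    ... | yes x∈R | no  y∉R = inj₁ (x∈R , y∉R)
    ... | no  x∉R | yes y∈R = inj₂ (x∉R , y∈R)
    ... | no  x∉R | no  y∉R = ⊥-elim (¬out (x∉R , y∉R))

module _ {G P : EdgeList n} {F : FaultSet n} {f : ℕ} (deg≤f : DegBounded G F f)
         {R : Subset n} (closed : Closed P F R) (fault-free : ∀ {x} → x ∈ R → x ∉ FV F) where

  damaged? : ∀ v u → Dec (HasEdge G v u × (u ∈ FV F ⊎ HasEdge (FE F) u v))
  damaged? v u = hasEdge? G v u ×-dec ((u ∈? FV F) ⊎-dec hasEdge? (FE F) u v)

  damagedNbrs : Fin n → Subset n
  damagedNbrs v = fromDec (damaged? v)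

  ∣damagedNbrs∣≤f : ∀ {v} → v ∉ FV F → ∣ damagedNbrs v ∣ ≤ f
  ∣damagedNbrs∣≤f {v} v∉F =
    subst (_≤ f) (sym (∣fromDec∣≡length-filter (damaged? v) id)) (deg≤f v v∉F)

  leaving⇒damaged : ∀ {a b} → a ∈ R → b ∉ R → HasEdge G a b → HasEdge P a b → b ∈ damagedNbrs a
  leaving⇒damaged {a} {b} a∈R b∉R ab∈G ab∈P = ∈-fromDec⁺ (damaged? a) (ab∈G , damaged)
    where
    damaged : b ∈ FV F ⊎ HasEdge (FE F) b a
    damaged with b ∈? FV F | hasEdge? (FE F) b a
    ... | yes b∈F | _        = inj₁ b∈F
    ... | no  _   | yes ba∈F = inj₂ ba∈F
    ... | no  b∉F | no  ba∉F = ⊥-elim (b∉R (closed a∈R (ab∈P , ba∉F ∘ HasEdge-sym (FE F) , b∉F)))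

  crossing-bound : ∀ {W C} → Distinct C → All (EdgeOf G) C → All (EdgeOf P) C → All (Within W) C →
                   All (Crosses R) C → length C ≤ ∣ W ∩ R ∣ * (f ⊓ ∣ W ─ R ∣)
  crossing-bound {W} {C} distinct C⊆G C⊆P C⊆W crosses =
    subst (_≤ _) (length-map (orient R) C) (length≤∣p∣*k (W ∩ R) N ∣N∣≤k unique oriented)
    where
    N : Fin n → Subset n
    N a = (W ─ R) ∩ damagedNbrs a
    ∣N∣≤k : ∀ {a} → a ∈ W ∩ R → ∣ N a ∣ ≤ f ⊓ ∣ W ─ R ∣
    ∣N∣≤k a∈A =
      ⊓-glb (≤-trans (∣p∩q∣≤∣q∣ (W ─ R) _) (∣damagedNbrs∣≤f (fault-free (proj₂ (x∈p∩q⁻ W R a∈A)))))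
            (∣p∩q∣≤∣p∣ (W ─ R) _)
    unique = AllPairs.map⁺ (AllPairs.map (λ ¬same → ¬same ∘ orient-injective) distinct)
    fibred : ∀ {e} → EdgeOf G e × EdgeOf P e × Within W e × Crosses R e →
             let (a , b) = orient R e in a ∈ W ∩ R × b ∈ N a
    fibred (e∈G , e∈P , e∈W , e-crosses) =
      let ((a∈W , a∈R) , (b∈W , b∉R)) = orient-crosses e∈W e-crosses
      in x∈p∩q⁺ (a∈W , a∈R) ,
         x∈p∩q⁺ (x∈p∧x∉q⇒x∈p─q b∈W b∉R ,
                 leaving⇒damaged a∈R b∉R (EdgeOf-orient G e∈G) (EdgeOf-orient P e∈P))
    oriented = All.map⁺ (All.map fibred (All.zip (C⊆G , All.zip (C⊆P , All.zip (C⊆W , crosses)))))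

record BalancedCut (P : EdgeList n) (F : FaultSet n) (W : Subset n) : Set where
  field
    side       : Subset n
    closed     : Closed P F side
    fault-free : ∀ {x} → x ∈ side → x ∉ FV F
    inner      : Nonempty (W ∩ side)
    outer      : Nonempty (W ─ side)
    balanced   : ∣ W ∩ side ∣ ≤ ∣ W ─ side ∣

module _ {P : EdgeList n} {F : FaultSet n} {W : Subset n} where

  private
    smallerComponent : ∀ {u v} (Cu : Component P F u) (Cv : Component P F v) →
                       ¬ Connected P F u v → u ∈ W → v ∈ W →
                       ∣ W ∩ Component.vertices Cu ∣ ≤ ∣ W ∩ Component.vertices Cv ∣ → BalancedCut P F W
    smallerComponent Cu Cv ¬uv u∈W v∈W ∣Wu∣≤∣Wv∣ = record
      { side       = U.vertices
      ; closed     = U.closed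
      ; fault-free = Connected-end∉ ∘ U.connected
      ; inner      = _ , x∈p∩q⁺ (u∈W , U.∋-source)
      ; outer      = _ , x∈p∧x∉q⇒x∈p─q v∈W (¬uv ∘ U.connected)
      ; balanced   = ≤-trans ∣Wu∣≤∣Wv∣ (p⊆q⇒∣p∣≤∣q∣ Wv⊆W─U)
      }
      where
      module U = Component Cu
      module V = Component Cv
      Wv⊆W─U : ∀ {x} → x ∈ W ∩ V.vertices → x ∈ W ─ U.vertices
      Wv⊆W─U x∈ = let (x∈W , x∈V) = x∈p∩q⁻ W V.vertices x∈ in
        x∈p∧x∉q⇒x∈p─q x∈W λ x∈U →
          ¬uv (Connected-trans (U.connected x∈U) (Connected-sym (V.connected x∈V)))

  balancedCut : ∀ {u v} → u ∉ FV F → v ∉ FV F → ¬ Connected P F u v → u ∈ W → v ∈ W →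
                BalancedCut P F W
  balancedCut {u} {v} u∉F v∉F ¬uv u∈W v∈W = pick (component P F u∉F) (component P F v∉F)
    where
    pick : Component P F u → Component P F v → BalancedCut P F W
    pick Cu Cv with ∣ W ∩ Component.vertices Cu ∣ ≤? ∣ W ∩ Component.vertices Cv ∣
    ... | yes ∣Wu∣≤∣Wv∣ = smallerComponent Cu Cv ¬uv u∈W v∈W ∣Wu∣≤∣Wv∣
    ... | no  ∣Wu∣≰∣Wv∣ =
      smallerComponent Cv Cu (¬uv ∘ Connected-sym) v∈W u∈W (<⇒≤ (≰⇒> ∣Wu∣≰∣Wv∣))

-- The potential

module Potential (f : ℕ) .{{_ : NonZero f}} where

  ℓ : ℕ → ℕ
  ℓ w = ⌊log₂ (w / f) ⌋

  Ψ : ℕ → ℕ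
  Ψ w = w * (w ⊓ (2 * f)) + f * w * ℓ w + w

  ℓ-mono : ∀ {a b} → a ≤ b → ℓ a ≤ ℓ b
  ℓ-mono a≤b = ⌊log₂⌋-mono-≤ (/-monoˡ-≤ f a≤b)

  k*f≤m⇒k≤m/f : ∀ k m → k * f ≤ m → k ≤ m / f
  k*f≤m⇒k≤m/f k m k*f≤m = subst (_≤ m / f) (m*n/n≡m k f) (/-monoˡ-≤ f k*f≤m)

  1+ℓ≤ℓ[s+t] : ∀ {s t} → s ≤ t → 2 * f < s + t → suc (ℓ s) ≤ ℓ (s + t)
  1+ℓ≤ℓ[s+t] {s} {t} s≤t 2f<s+t with s <? f
  ... | yes s<f = begin
    suc (ℓ s)  ≡⟨ cong (suc ∘ ⌊log₂_⌋) (m<n⇒m/n≡0 s<f) ⟩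
    ⌊log₂ 2 ⌋  ≤⟨ ⌊log₂⌋-mono-≤ (k*f≤m⇒k≤m/f 2 (s + t) (<⇒≤ 2f<s+t)) ⟩
    ℓ (s + t)  ∎
    where open ≤-Reasoning
  ... | no s≮f = begin
    suc (ℓ s)        ≡⟨ ⌊log₂[2*b]⌋≡1+⌊log₂b⌋ q ⟨
    ⌊log₂ (2 * q) ⌋  ≤⟨ ⌊log₂⌋-mono-≤ (k*f≤m⇒k≤m/f (2 * q) (s + t) 2qf≤s+t) ⟩
    ℓ (s + t)        ∎
    where
    open ≤-Reasoning
    q = s / f
    instance
      q-nonZero : NonZero q
      q-nonZero = >-nonZero (k*f≤m⇒k≤m/f 1 s (subst (_≤ s) (sym (*-identityˡ f)) (≮⇒≥ s≮f)))
    2qf≤s+t : 2 * q * f ≤ s + t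
    2qf≤s+t = begin
      2 * q * f    ≡⟨ *-assoc 2 q f ⟩
      2 * (q * f)  ≤⟨ *-monoʳ-≤ 2 (m/n*n≤m s f) ⟩
      s + (s + 0)  ≡⟨ cong (s +_) (+-identityʳ s) ⟩
      s + s        ≤⟨ +-monoʳ-≤ s s≤t ⟩
      s + t        ∎

  private
    Q L : ℕ → ℕ
    Q w = w * (w ⊓ (2 * f))
    L w = f * w * ℓ w

    L-sum : ∀ s t {a b k} → a ≤ k → b ≤ k → f * s * a + f * t * b ≤ f * (s + t) * k
    L-sum s t {a} {b} {k} a≤k b≤k = begin
      f * s * a + f * t * b  ≤⟨ +-mono-≤ (*-monoʳ-≤ (f * s) a≤k) (*-monoʳ-≤ (f * t) b≤k) ⟩
      f * s * k + f * t * k  ≡⟨ solve 4 (λ f s t k → f :* s :* k :+ f :* t :* k := f :* (s :+ t) :* k)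
                                        refl f s t k ⟩
      f * (s + t) * k        ∎
      where open ≤-Reasoning

    cost-small : ∀ {s t} → s + t ≤ 2 * f → Q s + Q t + s * (f ⊓ t) + (L s + L t) ≤ Q (s + t) + L (s + t)
    cost-small {s} {t} s+t≤2f = +-mono-≤ quadratic (L-sum s t (ℓ-mono (m≤m+n s t)) (ℓ-mono (m≤n+m t s)))
      where
      open ≤-Reasoning
      quadratic : Q s + Q t + s * (f ⊓ t) ≤ Q (s + t)
      quadratic = begin
        Q s + Q t + s * (f ⊓ t)        ≡⟨ cong₂ (λ x y → s * x + t * y + s * (f ⊓ t))
                                                (m≤n⇒m⊓n≡m (≤-trans (m≤m+n s t) s+t≤2f))
                                                (m≤n⇒m⊓n≡m (≤-trans (m≤n+m t s) s+t≤2f)) ⟩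
        s * s + t * t + s * (f ⊓ t)    ≤⟨ +-monoʳ-≤ (s * s + t * t) (*-monoʳ-≤ s (m⊓n≤n f t)) ⟩
        s * s + t * t + s * t          ≤⟨ m≤m+n _ (s * t) ⟩
        s * s + t * t + s * t + s * t  ≡⟨ solve 2 (λ s t → s :* s :+ t :* t :+ s :* t :+ s :* t
                                                          := (s :+ t) :* (s :+ t)) refl s t ⟩
        (s + t) * (s + t)              ≡⟨ cong ((s + t) *_) (m≤n⇒m⊓n≡m s+t≤2f) ⟨
        Q (s + t)                      ∎

    -- Beyond 2f the at most s·f crossing edges are paid for by one extra level of ℓ on the smaller side.
    cost-large : ∀ {s t} → s ≤ t → 2 * f < s + t →
                 Q s + Q t + s * (f ⊓ t) + (L s + L t) ≤ Q (s + t) + L (s + t)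
    cost-large {s} {t} s≤t 2f<s+t = begin
      Q s + Q t + s * (f ⊓ t) + (L s + L t)
        ≤⟨ +-monoˡ-≤ (L s + L t) (+-mono-≤ (+-mono-≤ (*-monoʳ-≤ s (m⊓n≤n s (2 * f)))
                                                     (*-monoʳ-≤ t (m⊓n≤n t (2 * f))))
                                          (*-monoʳ-≤ s (m⊓n≤m f t))) ⟩
      s * (2 * f) + t * (2 * f) + s * f + (L s + L t)
        ≡⟨ solve 5 (λ f s t a b → s :* (con 2 :* f) :+ t :* (con 2 :* f) :+ s :* f :+ (f :* s :* a :+ b)
                                  := (s :+ t) :* (con 2 :* f) :+ (f :* s :* (con 1 :+ a) :+ b))
                   refl f s t (ℓ s) (L t) ⟩
      (s + t) * (2 * f) + (f * s * suc (ℓ s) + L t)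
        ≤⟨ +-monoʳ-≤ ((s + t) * (2 * f))
                     (L-sum s t (1+ℓ≤ℓ[s+t] s≤t 2f<s+t) (ℓ-mono (m≤n+m t s))) ⟩
      (s + t) * (2 * f) + L (s + t)
        ≡⟨ cong (λ m → (s + t) * m + L (s + t)) (m≥n⇒m⊓n≡n (<⇒≤ 2f<s+t)) ⟨
      Q (s + t) + L (s + t)
        ∎
      where open ≤-Reasoning

    cost : ∀ {s t} → s ≤ t → Q s + Q t + s * (f ⊓ t) + (L s + L t) ≤ Q (s + t) + L (s + t)
    cost {s} {t} s≤t with s + t ≤? 2 * f
    ... | yes s+t≤2f = cost-small {s} {t} s+t≤2f
    ... | no  s+t≰2f = cost-large s≤t (≰⇒> s+t≰2f)

  Ψ-superadditive : ∀ {s t} → s ≤ t → Ψ s + Ψ t + s * (f ⊓ t) ≤ Ψ (s + t)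
  Ψ-superadditive {s} {t} s≤t = begin
    Ψ s + Ψ t + s * (f ⊓ t)
      ≡⟨ solve 7 (λ a b c d e s t → (a :+ b :+ s) :+ (c :+ d :+ t) :+ e
                                    := (a :+ c :+ e :+ (b :+ d)) :+ (s :+ t))
               refl (Q s) (L s) (Q t) (L t) (s * (f ⊓ t)) s t ⟩
    Q s + Q t + s * (f ⊓ t) + (L s + L t) + (s + t)
      ≤⟨ +-monoˡ-≤ (s + t) (cost {s} {t} s≤t) ⟩
    Ψ (s + t)
      ∎
    where open ≤-Reasoning

  w≤Ψw : ∀ w → w ≤ Ψ w
  w≤Ψw w = m≤n+m w _

  Ψ≤2fwℓ : ∀ {w} → 10 * f < w → Ψ w ≤ 2 * f * w * ℓ w
  Ψ≤2fwℓ {w} 10f<w = begin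
    Ψ w                        ≤⟨ +-mono-≤ (+-monoˡ-≤ (L w) (*-monoʳ-≤ w (m⊓n≤n w (2 * f))))
                                           (m≤n*m w f) ⟩
    w * (2 * f) + L w + f * w  ≡⟨ solve 3 (λ f w l → w :* (con 2 :* f) :+ f :* w :* l :+ f :* w
                                                   := f :* w :* l :+ f :* w :* con 3) refl f w (ℓ w) ⟩
    L w + f * w * 3            ≤⟨ +-monoʳ-≤ (L w) (*-monoʳ-≤ (f * w) 3≤ℓw) ⟩
    L w + L w                  ≡⟨ solve 3 (λ f w l → f :* w :* l :+ f :* w :* l := con 2 :* f :* w :* l)
                                          refl f w (ℓ w) ⟩
    2 * f * w * ℓ w            ∎
    where
    open ≤-Reasoning
    3≤ℓw : 3 ≤ ℓ w
    3≤ℓw = ⌊log₂⌋-mono-≤ (k*f≤m⇒k≤m/f 8 w (≤-trans (*-monoˡ-≤ f (m≤m+n 8 2)) (<⇒≤ 10f<w)))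

module _ (G : EdgeList n) (f : ℕ) .{{_ : NonZero f}} where
  open Potential f

  1+length≤Ψ : ∀ W → Nonempty W → ∀ {L} → Blocked G f L → All (Within W) L →
               suc (length L) ≤ Ψ ∣ W ∣
  1+length≤Ψ W = go W (<-wellFounded ∣ W ∣)
    where
    go : ∀ W → Acc _<_ ∣ W ∣ → Nonempty W → ∀ {L} → Blocked G f L → All (Within W) L →
         suc (length L) ≤ Ψ ∣ W ∣
    go W _ (_ , x∈W) [] _ = ≤-trans (x∈p⇒1≤∣p∣ x∈W) (w≤Ψw ∣ W ∣)
    go W (acc rec) _ (snoc {P} {u , v} bP _ (F , deg≤f , ¬dmg , ¬uv)) L⊆W = begin
      suc (length (P ∷ʳ (u , v)))                    ≡⟨ cong suc (trans (length-++ P) (+-comm _ 1)) ⟩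
      2 + length P                                   ≡⟨ cong (2 +_) (length-partition R P) ⟩
      2 + (length PA + (length PB + length PC))      ≡⟨ solve 3 (λ a b c → con 2 :+ (a :+ (b :+ c))
                                                                    := con 1 :+ a :+ (con 1 :+ b) :+ c)
                                                              refl (length PA) (length PB) (length PC) ⟩
      suc (length PA) + suc (length PB) + length PC  ≤⟨ +-mono-≤ (+-mono-≤ IH-A IH-B) crossing ⟩
      Ψ ∣ A ∣ + Ψ ∣ B ∣ + ∣ A ∣ * (f ⊓ ∣ B ∣)            ≤⟨ Ψ-superadditive balanced ⟩
      Ψ (∣ A ∣ + ∣ B ∣)                                ≡⟨ cong Ψ ∣W∣≡∣A∣+∣B∣ ⟨
      Ψ ∣ W ∣                                         ∎
      where
      open ≤-Reasoning
      P⊆W = All.++⁻ˡ P L⊆W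
      uv⊆W = All.head (All.++⁻ʳ P L⊆W)
      open BalancedCut (balancedCut (¬dmg ∘ inj₁) (¬dmg ∘ inj₂ ∘ inj₁) ¬uv (proj₁ uv⊆W) (proj₂ uv⊆W))
             renaming (side to R)
      A = W ∩ R
      B = W ─ R
      PA = insideEdges R P
      PB = outsideEdges R P
      PC = crossingEdges R P
      ∣W∣≡∣A∣+∣B∣ = ∣p∣≡∣p∩q∣+∣p─q∣ W R
      IH-A : suc (length PA) ≤ Ψ ∣ A ∣
      IH-A = go A (rec (subst (∣ A ∣ <_) (sym ∣W∣≡∣A∣+∣B∣) (m<m+n ∣ A ∣ (x∈p⇒1≤∣p∣ (proj₂ outer)))))
                inner (Blocked-filter G f _ bP) (insideEdges-within R P⊆W)
      IH-B : suc (length PB) ≤ Ψ ∣ B ∣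
      IH-B = go B (rec (subst (∣ B ∣ <_) (sym ∣W∣≡∣A∣+∣B∣) (m<n+m ∣ B ∣ (x∈p⇒1≤∣p∣ (proj₂ inner)))))
                outer (Blocked-filter G f _ (Blocked-filter G f _ bP)) (outsideEdges-within R P⊆W)
      crossing : length PC ≤ ∣ A ∣ * (f ⊓ ∣ B ∣)
      crossing = crossing-bound deg≤f closed fault-free
        (Blocked⇒Distinct G f (Blocked-filter G f _ (Blocked-filter G f _ bP)))
        (crossingEdges⁺ R (Blocked⇒EdgesOf G f bP)) (crossingEdges⁺ R (All.tabulate ∈⇒EdgeOf))
        (crossingEdges⁺ R P⊆W) (crossingEdges-cross R P)

blocked-length≤ : ∀ {n f} .{{_ : NonZero f}} → 10 * f < n → {G L : EdgeList n} → Blocked G f L →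
                  length L ≤ 2 * f * n * ⌊log₂ (n / f) ⌋
blocked-length≤ {n} {f} 10f<n {G} {L} bL = ≤-trans (n≤1+n _) (≤-trans 1+length≤Ψn (Ψ≤2fwℓ 10f<n))
  where
  open Potential f
  1+length≤Ψn : 1 + length L ≤ Ψ n
  1+length≤Ψn = subst (λ m → 1 + length L ≤ Ψ m) (∣⊤∣≡n n)
    (1+length≤Ψ G f ⊤ (fromℕ< (≤-trans (s≤s z≤n) 10f<n) , ∈⊤) bL
                (All.universal (λ _ → ∈⊤ , ∈⊤) L))

mainTheorem4 : Σ ℕ (λ C →
    ((n f : ℕ) .{{_ : NonZero f}} → 10 * f < n →
      (G : EdgeList n) → IsSimple G → HasMFDBlockingSet G f →
      length G ≤ C * f * n * ⌊log₂ (n / f) ⌋)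
  × ((n f : ℕ) .{{_ : NonZero f}} → 10 * f < n →
      (G : EdgeList n) → IsSimple G → (H : EdgeList n) → GreedyOutput G f H →
      length H ≤ C * f * n * ⌊log₂ (n / f) ⌋))
mainTheorem4 = 2 , (λ n f 10f<n G _ mfd     → blocked-length≤ 10f<n (MFD⇒Blocked G f mfd))
                 , (λ n f 10f<n G _ H greedy → blocked-length≤ 10f<n (Greedy⇒Blocked G f greedy))
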